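{- Let $\mathbf{K}$ be a finite set of finite subdirectly irreducible Heyting algebras with involution, and let $\mathbf{V}=V(\mathbf{K})$ be the variety generated by $\mathbf{K}$. Then $\mathbf{V}$ is a discriminator variety.
   Context: A Heyting algebra with involution is an algebra $\langle A,\lor,\land,\to,\neg,\sim,0,1\rangle$ where $\langle A,\lor,\land,\to,\neg,0,1\rangle$ is a Heyting algebra ($a\to b=\sup\{x:a\land x\le b\}$, $\neg a=a\to 0$) and $\sim$ satisfies $\sim(a\lor b)=\sim a\land\sim b$ and $\sim\sim a=a$. An algebra is subdirectly irreducible if whenever an intersection of a family of its congruences equals the identity relation, one of the congruences is the identity relation. A ternary term $t(x,y,z)$ is a discriminator for an algebra $\mathbf{A}$ if $t^{\mathbf{A}}(a,b,c)=a$ when $a\ne b$ and $t^{\mathbf{A}}(a,b,c)=c$ when $a=b$. A variety $\mathbf{V}$ is a discriminator variety if $\mathbf{V}$ is generated by some class $\mathbf{K}'\subseteq\mathbf{V}$ for which there is a single ternary term that is a discriminator for every algebra in $\mathbf{K}'$. -}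

module Defs where

open import Level using (Level; suc; _⊔_)
open import Data.Nat using (ℕ)
open import Data.Fin as Fin using (Fin)
open import Data.Product using (Σ; _×_; _,_)
open import Data.List using (List)
open import Data.List.Membership.Propositional using (_∈_)
open import Function.Bundles using (_↔_; _⇔_)
open import Relation.Nullary using (¬_)
open import Relation.Unary using (Pred)
open import Relation.Binary.Core using (Rel)
open import Relation.Binary.Structures using (IsEquivalence)
open import Relation.Binary.PropositionalEquality using (_≡_)
open import Relation.Binary.Lattice.Structures using (IsHeytingAlgebra)

record Algebra (a : Level) : Set (suc a) where
  field
    Carrier : Set a
    _∨_ _∧_ _⇒_ : Carrier → Carrier → Carrier
    neg ∼_ : Carrier → Carrier
    𝟘 𝟙 : Carrier

  _≤_ : Carrier → Carrier → Set a
  x ≤ y = (x ∧ y) ≡ x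

record IsHAI {a} (A : Algebra a) : Set a where
  open Algebra A
  field
    isHeytingAlgebra : IsHeytingAlgebra _≡_ _≤_ _∨_ _∧_ _⇒_ 𝟙 𝟘
    neg-def          : ∀ x → (neg x) ≡ (x ⇒ 𝟘)
    ∼-∨              : ∀ x y → (∼ (x ∨ y)) ≡ ((∼ x) ∧ (∼ y))
    ∼-invol          : ∀ x → (∼ (∼ x)) ≡ x

Finite : ∀ {a} → Algebra a → Set a
Finite A = Σ ℕ λ n → Algebra.Carrier A ↔ Fin n

record Congruence {a} (A : Algebra a) : Set (suc a) where
  open Algebra A
  field
    θ       : Rel Carrier a
    isEquiv : IsEquivalence θ
    ∨-cong  : ∀ {x y u v} → θ x y → θ u v → θ (x ∨ u) (y ∨ v)
    ∧-cong  : ∀ {x y u v} → θ x y → θ u v → θ (x ∧ u) (y ∧ v)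
    ⇒-cong  : ∀ {x y u v} → θ x y → θ u v → θ (x ⇒ u) (y ⇒ v)
    ¬-cong  : ∀ {x y} → θ x y → θ (neg x) (neg y)
    ∼-cong  : ∀ {x y} → θ x y → θ (∼ x) (∼ y)

-- a congruence is the identity relation (Δ ⊆ θ holds by reflexivity)
IsIdentity : ∀ {a} {A : Algebra a} → Congruence A → Set a
IsIdentity {A = A} C = ∀ (x y : Algebra.Carrier A) → Congruence.θ C x y → x ≡ y

SubdirectlyIrreducible : ∀ {a} → Algebra a → Set (suc a)
SubdirectlyIrreducible {a} A =
  (I : Set a) (Θ : I → Congruence A) →
  (∀ (x y : Algebra.Carrier A) → (∀ i → Congruence.θ (Θ i) x y) → x ≡ y) →
  Σ I λ i → IsIdentity (Θ i)

data Term (n : ℕ) : Set where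
  var          : Fin n → Term n
  _∨'_ _∧'_ _⇒'_ : Term n → Term n → Term n
  ¬'_ ∼'_      : Term n → Term n
  𝟘' 𝟙'        : Term n

⟦_⟧ : ∀ {a n} → Term n → (A : Algebra a) → (Fin n → Algebra.Carrier A) → Algebra.Carrier A
⟦ var i ⟧   A ρ = ρ i
⟦ s ∨' t ⟧  A ρ = Algebra._∨_ A (⟦ s ⟧ A ρ) (⟦ t ⟧ A ρ)
⟦ s ∧' t ⟧  A ρ = Algebra._∧_ A (⟦ s ⟧ A ρ) (⟦ t ⟧ A ρ)
⟦ s ⇒' t ⟧  A ρ = Algebra._⇒_ A (⟦ s ⟧ A ρ) (⟦ t ⟧ A ρ)
⟦ ¬' s ⟧    A ρ = Algebra.neg A (⟦ s ⟧ A ρ)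
⟦ ∼' s ⟧    A ρ = Algebra.∼_ A (⟦ s ⟧ A ρ)
⟦ 𝟘' ⟧      A ρ = Algebra.𝟘 A
⟦ 𝟙' ⟧      A ρ = Algebra.𝟙 A

_⊨_≈_ : ∀ {a n} → Algebra a → Term n → Term n → Set a
A ⊨ s ≈ t = ∀ ρ → ⟦ s ⟧ A ρ ≡ ⟦ t ⟧ A ρ

Class : (a : Level) → Set (suc (suc a))
Class a = Pred (Algebra a) (suc a)

_⊆ᶜ_ : ∀ {a} → Class a → Class a → Set (suc a)
K ⊆ᶜ L = ∀ A → K A → L A

-- V(K): the variety generated by K, i.e. the equational class of all
-- algebras satisfying every identity that holds in all members of K
V : ∀ {a} → Class a → Class a
V K A = ∀ (n : ℕ) (s t : Term n) → (∀ B → K B → B ⊨ s ≈ t) → A ⊨ s ≈ t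

fromList : ∀ {a} → List (Algebra a) → Class a
fromList K A = A ∈ K

IsDiscriminator : ∀ {a} → Term 3 → Algebra a → Set a
IsDiscriminator t A =
  (∀ (x y z : Algebra.Carrier A) → ¬ (x ≡ y) → ⟦ t ⟧ A (v x y z) ≡ x) ×
  (∀ (x z : Algebra.Carrier A) → ⟦ t ⟧ A (v x x z) ≡ z)
  where
  v : Algebra.Carrier A → Algebra.Carrier A → Algebra.Carrier A → Fin 3 → Algebra.Carrier A
  v x y z Fin.zero = x
  v x y z (Fin.suc Fin.zero) = y
  v x y z (Fin.suc (Fin.suc Fin.zero)) = z

IsDiscriminatorVariety : ∀ {a} → Class a → Set (suc (suc a))
IsDiscriminatorVariety {a} 𝐕 =
  Σ (Class a) λ K′ →
    (K′ ⊆ᶜ 𝐕) ×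
    (∀ A → V K′ A ⇔ 𝐕 A) ×
    Σ (Term 3) λ t → ∀ A → K′ A → IsDiscriminator t A

-- If e ∧ ∼e = 𝟘 then e ∨ ∼e = 𝟙, and u ↦ (u ∧ e, u ∧ ∼e) separates points, so the two
-- congruences "equal below e" and "equal below ∼e" meet in the identity; in a subdirectly
-- irreducible algebra one of them is trivial, i.e. e is 𝟙 or 𝟘. The operation □x = x ∧ ¬∼x
-- is deflationary and its fixed points satisfy c ∧ ∼c = 𝟘, so in a finite subdirectly
-- irreducible algebra with at most k elements □ᵏ maps 𝟙 to 𝟙 and every x ≠ 𝟙 to 𝟘. With
-- d = □ᵏ(x ↔ y), the term (d ∧ z) ∨ (¬d ∧ x) is then a discriminator, uniformly for all
-- members of K once k bounds their cardinalities; and K generates V(K).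
module Submission where

open import Defs
open import Level using (Level; Lift; lift)
open import Data.Bool using (Bool; true; false)
open import Data.Nat as ℕ using (ℕ; zero; suc; _+_)
import Data.Nat.Properties as ℕ
open import Data.Fin as Fin using (Fin; toℕ)
import Data.Fin.Properties as Fin
open import Data.List using (List; []; _∷_)
open import Data.List.Relation.Unary.All as All using (All; []; _∷_)
open import Data.List.Relation.Unary.Any using (here; there)
open import Data.List.Membership.Propositional using (_∈_)
open import Data.Product using (Σ; ∃; _×_; _,_; proj₁; proj₂)
open import Data.Sum using (_⊎_; inj₁; inj₂)
open import Data.Empty using (⊥-elim)
open import Function using (_∘_; Inverse; Injection; mk⇔)
open import Function.Properties.Inverse using (↔⇒↣)
open import Relation.Nullary using (¬_)
open import Relation.Binary.PropositionalEquality
open import Relation.Binary.Lattice.Bundles using (HeytingAlgebra)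
import Relation.Binary.Lattice.Properties.HeytingAlgebra as HeytingAlgebraProperties
import Relation.Binary.Lattice.Properties.Lattice as LatticeProperties
import Relation.Binary.Lattice.Properties.JoinSemilattice as JoinSemilatticeProperties
import Relation.Binary.Lattice.Properties.BoundedJoinSemilattice as BoundedJoinSemilatticeProperties
import Algebra.Lattice as AlgebraLattice

□' : ∀ {n} → Term n → Term n
□' s = s ∧' (¬' (∼' s))

□'^ : ∀ {n} → ℕ → Term n → Term n
□'^ zero    s = s
□'^ (suc k) s = □' (□'^ k s)

_⇔'_ : ∀ {n} → Term n → Term n → Term n
s ⇔' t = (s ⇒' t) ∧' (t ⇒' s)

x₀ x₁ x₂ : Fin 3
x₀ = Fin.zero
x₁ = Fin.suc Fin.zero
x₂ = Fin.suc (Fin.suc Fin.zero)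

discriminatorTerm : ℕ → Term 3
discriminatorTerm k = (d ∧' var x₂) ∨' ((¬' d) ∧' var x₀)
  where
  d : Term 3
  d = □'^ k (var x₀ ⇔' var x₁)

module HeytingAlgebraWithInvolution {a} (A : Algebra a) (hai : IsHAI A) where
  open Algebra A
  open IsHAI hai

  heytingAlgebra : HeytingAlgebra a a a
  heytingAlgebra = record { isHeytingAlgebra = isHeytingAlgebra }

  open HeytingAlgebra heytingAlgebra
    using ( x∧y≤x; x∧y≤y; ∧-greatest; x≤x∨y; y≤x∨y; ∨-least; antisym; maximum; minimum
          ; transpose-⇨; transpose-∧; joinSemilattice; boundedJoinSemilattice; lattice )
    renaming (refl to ≤-refl; trans to ≤-trans)
  open HeytingAlgebraProperties heytingAlgebra using (⇨-eval; ⇨-unit; ∧-distribˡ-∨)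
  open AlgebraLattice.IsLattice (LatticeProperties.isAlgLattice lattice) using (∧-comm)
  open JoinSemilatticeProperties joinSemilattice using (x≤y⇒x∨y≈y)
  open BoundedJoinSemilatticeProperties boundedJoinSemilattice
    renaming (identityˡ to ∨-identityˡ; identityʳ to ∨-identityʳ)

  ∧-identityˡ : ∀ x → 𝟙 ∧ x ≡ x
  ∧-identityˡ x = trans (∧-comm 𝟙 x) (maximum x)

  ≤𝟘⇒≡𝟘 : ∀ {x} → x ≤ 𝟘 → x ≡ 𝟘
  ≤𝟘⇒≡𝟘 p = antisym p (minimum _)

  𝟙≤⇒≡𝟙 : ∀ {x} → 𝟙 ≤ x → x ≡ 𝟙
  𝟙≤⇒≡𝟙 p = antisym (maximum _) p

  x∧negx≤𝟘 : ∀ x → (x ∧ neg x) ≤ 𝟘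
  x∧negx≤𝟘 x rewrite neg-def x = subst (_≤ 𝟘) (∧-comm _ x) ⇨-eval

  neg-𝟘 : neg 𝟘 ≡ 𝟙
  neg-𝟘 = trans (neg-def 𝟘) ⇨-unit

  neg-𝟙 : neg 𝟙 ≡ 𝟘
  neg-𝟙 = ≤𝟘⇒≡𝟘 (subst (_≤ 𝟘) (∧-identityˡ (neg 𝟙)) (x∧negx≤𝟘 𝟙))

  ⇒≡𝟙⇒≤ : ∀ {x y} → x ⇒ y ≡ 𝟙 → x ≤ y
  ⇒≡𝟙⇒≤ {x} {y} p = subst (_≤ y) (∧-identityˡ x) (transpose-∧ (subst (𝟙 ≤_) (sym p) (maximum 𝟙)))

  ⇔≡𝟙⇒≡ : ∀ {x y} → ((x ⇒ y) ∧ (y ⇒ x)) ≡ 𝟙 → x ≡ y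
  ⇔≡𝟙⇒≡ p = antisym (⇒≡𝟙⇒≤ (𝟙≤⇒≡𝟙 (subst (_≤ _) p (x∧y≤x _ _))))
                    (⇒≡𝟙⇒≤ (𝟙≤⇒≡𝟙 (subst (_≤ _) p (x∧y≤y _ _))))

  ⇔-refl : ∀ x → ((x ⇒ x) ∧ (x ⇒ x)) ≡ 𝟙
  ⇔-refl x rewrite ⇨-unit {x} = maximum 𝟙

  ∼-antitone : ∀ {x y} → x ≤ y → (∼ y) ≤ (∼ x)
  ∼-antitone {x} {y} p = subst (λ w → (∼ w) ≤ (∼ x)) (x≤y⇒x∨y≈y p)
                           (subst (_≤ (∼ x)) (sym (∼-∨ x y)) (x∧y≤x (∼ x) (∼ y)))

  ∼-∧ : ∀ x y → ∼ (x ∧ y) ≡ ((∼ x) ∨ (∼ y))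
  ∼-∧ x y = begin
    ∼ (x ∧ y)                   ≡⟨ cong₂ (λ u v → ∼ (u ∧ v)) (sym (∼-invol x)) (sym (∼-invol y)) ⟩
    ∼ ((∼ (∼ x)) ∧ (∼ (∼ y)))   ≡⟨ cong ∼_ (sym (∼-∨ (∼ x) (∼ y))) ⟩
    ∼ (∼ ((∼ x) ∨ (∼ y)))       ≡⟨ ∼-invol _ ⟩
    (∼ x) ∨ (∼ y)               ∎
    where open ≡-Reasoning

  ∼-𝟙 : ∼ 𝟙 ≡ 𝟘
  ∼-𝟙 = ≤𝟘⇒≡𝟘 (subst ((∼ 𝟙) ≤_) (∼-invol 𝟘) (∼-antitone (maximum (∼ 𝟘))))

  ∼-𝟘 : ∼ 𝟘 ≡ 𝟙
  ∼-𝟘 = trans (cong ∼_ (sym ∼-𝟙)) (∼-invol 𝟙)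

  module CongruenceBelow (e : Carrier) (e∧∼e≡𝟘 : (e ∧ (∼ e)) ≡ 𝟘) where

    _≈ₑ_ : Carrier → Carrier → Set a
    u ≈ₑ v = (u ∧ e) ≡ (v ∧ e)

    ≤-transportₑ : ∀ {w x y} → w ≤ e → w ≤ x → x ≈ₑ y → w ≤ y
    ≤-transportₑ {w} {x} {y} w≤e w≤x x≈y =
      ≤-trans (subst (w ≤_) x≈y (∧-greatest w≤x w≤e)) (x∧y≤x y e)

    ≈ₑ-intro : ∀ {u v} → (∀ {w} → w ≤ e → w ≤ u → w ≤ v) → (∀ {w} → w ≤ e → w ≤ v → w ≤ u) → u ≈ₑ v
    ≈ₑ-intro {u} {v} u⊆v v⊆u =
      antisym (∧-greatest (u⊆v (x∧y≤y u e) (x∧y≤x u e)) (x∧y≤y u e))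
              (∧-greatest (v⊆u (x∧y≤y v e) (x∧y≤x v e)) (x∧y≤y v e))

    ∨-compatible : ∀ {x y u v} → x ≈ₑ y → u ≈ₑ v → ∀ {w} → w ≤ e → w ≤ (x ∨ u) → w ≤ (y ∨ v)
    ∨-compatible {x} {y} {u} {v} x≈y u≈v {w} w≤e w≤x∨u =
      ≤-trans (subst (w ≤_) (∧-distribˡ-∨ w x u) (∧-greatest ≤-refl w≤x∨u))
        (∨-least (≤-trans (≤-transportₑ (≤-trans (x∧y≤x w x) w≤e) (x∧y≤y w x) x≈y) (x≤x∨y y v))
                 (≤-trans (≤-transportₑ (≤-trans (x∧y≤x w u) w≤e) (x∧y≤y w u) u≈v) (y≤x∨y y v)))

    ∧-compatible : ∀ {x y u v} → x ≈ₑ y → u ≈ₑ v → ∀ {w} → w ≤ e → w ≤ (x ∧ u) → w ≤ (y ∧ v)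
    ∧-compatible {x} {y} {u} {v} x≈y u≈v w≤e w≤x∧u =
      ∧-greatest (≤-transportₑ w≤e (≤-trans w≤x∧u (x∧y≤x x u)) x≈y)
                 (≤-transportₑ w≤e (≤-trans w≤x∧u (x∧y≤y x u)) u≈v)

    ⇒-compatible : ∀ {x y u v} → x ≈ₑ y → u ≈ₑ v → ∀ {w} → w ≤ e → w ≤ (x ⇒ u) → w ≤ (y ⇒ v)
    ⇒-compatible {x} {y} {u} {v} x≈y u≈v {w} w≤e w≤x⇒u = transpose-⇨ w∧y≤v
      where
      w∧y≤e : (w ∧ y) ≤ e
      w∧y≤e = ≤-trans (x∧y≤x w y) w≤e
      w∧y≤x : (w ∧ y) ≤ x
      w∧y≤x = ≤-transportₑ w∧y≤e (x∧y≤y w y) (sym x≈y)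
      w∧y≤u : (w ∧ y) ≤ u
      w∧y≤u = ≤-trans (∧-greatest (≤-trans (x∧y≤x w y) w≤x⇒u) w∧y≤x) ⇨-eval
      w∧y≤v : (w ∧ y) ≤ v
      w∧y≤v = ≤-transportₑ w∧y≤e w∧y≤u u≈v

    -- The only place where e ∧ ∼e = 𝟘 is needed.
    ∼-compatible : ∀ {x y} → x ≈ₑ y → ∀ {w} → w ≤ e → w ≤ (∼ x) → w ≤ (∼ y)
    ∼-compatible {x} {y} x≈y {w} w≤e w≤∼x =
      ≤-trans (subst (w ≤_) (∧-distribˡ-∨ e (∼ y) (∼ e)) w≤e∧[∼y∨∼e])
        (∨-least (x∧y≤y e (∼ y)) (subst (_≤ (∼ y)) (sym e∧∼e≡𝟘) (minimum (∼ y))))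
      where
      y∧e≤x : (y ∧ e) ≤ x
      y∧e≤x = ≤-transportₑ (x∧y≤y y e) (x∧y≤x y e) (sym x≈y)
      w≤e∧[∼y∨∼e] : w ≤ (e ∧ ((∼ y) ∨ (∼ e)))
      w≤e∧[∼y∨∼e] = ∧-greatest w≤e (≤-trans w≤∼x (subst ((∼ x) ≤_) (∼-∧ y e) (∼-antitone y∧e≤x)))

    congruence : Congruence A
    congruence = record
      { θ       = _≈ₑ_
      ; isEquiv = record { refl = refl ; sym = sym ; trans = trans }
      ; ∨-cong  = λ p q → ≈ₑ-intro (∨-compatible p q) (∨-compatible (sym p) (sym q))
      ; ∧-cong  = λ p q → ≈ₑ-intro (∧-compatible p q) (∧-compatible (sym p) (sym q))
      ; ⇒-cong  = λ p q → ≈ₑ-intro (⇒-compatible p q) (⇒-compatible (sym p) (sym q))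
      ; ¬-cong  = λ {x} {y} p → subst₂ _≈ₑ_ (sym (neg-def x)) (sym (neg-def y))
                                  (≈ₑ-intro (⇒-compatible p refl) (⇒-compatible (sym p) refl))
      ; ∼-cong  = λ p → ≈ₑ-intro (∼-compatible p) (∼-compatible (sym p))
      }

    isIdentity⇒≡𝟙 : IsIdentity congruence → e ≡ 𝟙
    isIdentity⇒≡𝟙 identity = identity e 𝟙 (trans (antisym (x∧y≤x e e) (∧-greatest ≤-refl ≤-refl)) (sym (∧-identityˡ e)))

  module ∼-Complemented {e : Carrier} (e∧∼e≡𝟘 : (e ∧ (∼ e)) ≡ 𝟘) where
    open ≡-Reasoning

    ∼e∧∼∼e≡𝟘 : ((∼ e) ∧ (∼ (∼ e))) ≡ 𝟘
    ∼e∧∼∼e≡𝟘 = begin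
      (∼ e) ∧ (∼ (∼ e))  ≡⟨ cong ((∼ e) ∧_) (∼-invol e) ⟩
      (∼ e) ∧ e          ≡⟨ ∧-comm (∼ e) e ⟩
      e ∧ (∼ e)          ≡⟨ e∧∼e≡𝟘 ⟩
      𝟘                  ∎

    e∨∼e≡𝟙 : (e ∨ (∼ e)) ≡ 𝟙
    e∨∼e≡𝟙 = begin
      e ∨ (∼ e)                 ≡⟨ sym (∼-invol _) ⟩
      ∼ (∼ (e ∨ (∼ e)))         ≡⟨ cong ∼_ (∼-∨ e (∼ e)) ⟩
      ∼ ((∼ e) ∧ (∼ (∼ e)))     ≡⟨ cong ∼_ ∼e∧∼∼e≡𝟘 ⟩
      ∼ 𝟘                       ≡⟨ ∼-𝟘 ⟩
      𝟙                         ∎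

    split : ∀ u → u ≡ ((u ∧ e) ∨ (u ∧ (∼ e)))
    split u = begin
      u                           ≡⟨ sym (maximum u) ⟩
      u ∧ 𝟙                       ≡⟨ cong (u ∧_) (sym e∨∼e≡𝟙) ⟩
      u ∧ (e ∨ (∼ e))             ≡⟨ ∧-distribˡ-∨ u e (∼ e) ⟩
      (u ∧ e) ∨ (u ∧ (∼ e))       ∎

    module Below-e  = CongruenceBelow e e∧∼e≡𝟘
    module Below-∼e = CongruenceBelow (∼ e) ∼e∧∼∼e≡𝟘

    Θ : Lift a Bool → Congruence A
    Θ (lift true)  = Below-e.congruence
    Θ (lift false) = Below-∼e.congruence

    ⋂Θ≡Δ : ∀ x y → (∀ i → Congruence.θ (Θ i) x y) → x ≡ y
    ⋂Θ≡Δ x y x≈y = begin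
      x                           ≡⟨ split x ⟩
      (x ∧ e) ∨ (x ∧ (∼ e))       ≡⟨ cong₂ _∨_ (x≈y (lift true)) (x≈y (lift false)) ⟩
      (y ∧ e) ∨ (y ∧ (∼ e))       ≡⟨ sym (split y) ⟩
      y                           ∎

    identity⇒𝟙-or-𝟘 : Σ (Lift a Bool) (IsIdentity ∘ Θ) → (e ≡ 𝟙) ⊎ (e ≡ 𝟘)
    identity⇒𝟙-or-𝟘 (lift true  , identity) = inj₁ (Below-e.isIdentity⇒≡𝟙 identity)
    identity⇒𝟙-or-𝟘 (lift false , identity) = inj₂ (begin
      e         ≡⟨ sym (∼-invol e) ⟩
      ∼ (∼ e)   ≡⟨ cong ∼_ (Below-∼e.isIdentity⇒≡𝟙 identity) ⟩
      ∼ 𝟙       ≡⟨ ∼-𝟙 ⟩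
      𝟘         ∎)

  ∼-complemented-𝟙-or-𝟘 : SubdirectlyIrreducible A → ∀ {e} → (e ∧ (∼ e)) ≡ 𝟘 → (e ≡ 𝟙) ⊎ (e ≡ 𝟘)
  ∼-complemented-𝟙-or-𝟘 si {e} e∧∼e≡𝟘 = identity⇒𝟙-or-𝟘 (si (Lift a Bool) Θ ⋂Θ≡Δ)
    where open ∼-Complemented e∧∼e≡𝟘

  □ : Carrier → Carrier
  □ x = x ∧ neg (∼ x)

  □^ : ℕ → Carrier → Carrier
  □^ zero    x = x
  □^ (suc k) x = □ (□^ k x)

  ⟦□'^⟧ : ∀ {n} k (s : Term n) ρ → ⟦ □'^ k s ⟧ A ρ ≡ □^ k (⟦ s ⟧ A ρ)
  ⟦□'^⟧ zero    s ρ = refl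
  ⟦□'^⟧ (suc k) s ρ rewrite ⟦□'^⟧ k s ρ = refl

  □^-antitone : ∀ {i j} x → i ℕ.≤ j → □^ j x ≤ □^ i x
  □^-antitone x = go ∘ ℕ.≤⇒≤′
    where
    go : ∀ {i j} → i ℕ.≤′ j → □^ j x ≤ □^ i x
    go ℕ.≤′-refl     = ≤-refl
    go (ℕ.≤′-step p) = ≤-trans (x∧y≤x _ _) (go p)

  □^-𝟙 : ∀ k → □^ k 𝟙 ≡ 𝟙
  □^-𝟙 zero = refl
  □^-𝟙 (suc k) rewrite □^-𝟙 k | ∼-𝟙 | neg-𝟘 = maximum 𝟙

  -- □ c ≡ c is literally c ≤ ¬∼c, whence c ∧ ∼c ≤ ¬∼c ∧ ∼c = 𝟘.
  □-fixed⇒∼-complemented : ∀ {c} → □ c ≡ c → (c ∧ (∼ c)) ≡ 𝟘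
  □-fixed⇒∼-complemented {c} c≤¬∼c =
    ≤𝟘⇒≡𝟘 (≤-trans (∧-greatest (≤-trans (x∧y≤x c (∼ c)) c≤¬∼c) (x∧y≤y c (∼ c)))
                   (subst (_≤ 𝟘) (∧-comm _ _) (x∧negx≤𝟘 (∼ c))))

  □^-stabilises : ((n , _) : Finite A) → ∀ x → ∃ λ i → i ℕ.< n × □^ (suc i) x ≡ □^ i x
  □^-stabilises (n , A↔Fin) x with Fin.pigeonhole (ℕ.n<1+n n) (λ i → Inverse.to A↔Fin (□^ (toℕ i) x))
  ... | i , j , i<j , same-image = toℕ i , ℕ.<-≤-trans i<j (ℕ.≤-pred (Fin.toℕ<n j)) , □^-fixed
    where
    □^i≡□^j : □^ (toℕ i) x ≡ □^ (toℕ j) x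
    □^i≡□^j = Injection.injective (↔⇒↣ A↔Fin) same-image
    □^-fixed : □^ (suc (toℕ i)) x ≡ □^ (toℕ i) x
    □^-fixed = antisym (x∧y≤x _ _) (subst (_≤ □^ (suc (toℕ i)) x) (sym □^i≡□^j) (□^-antitone x i<j))

  □^-eventually-𝟘 : SubdirectlyIrreducible A → ((n , _) : Finite A) →
                    ∀ {x k} → ¬ (x ≡ 𝟙) → n ℕ.≤ k → □^ k x ≡ 𝟘
  □^-eventually-𝟘 si fin {x} {k} x≢𝟙 n≤k with □^-stabilises fin x
  ... | i , i<n , fixed with ∼-complemented-𝟙-or-𝟘 si (□-fixed⇒∼-complemented fixed)
  ...   | inj₁ □^i≡𝟙 = ⊥-elim (x≢𝟙 (𝟙≤⇒≡𝟙 (subst (_≤ x) □^i≡𝟙 (□^-antitone {0} {i} x ℕ.z≤n))))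
  ...   | inj₂ □^i≡𝟘 = ≤𝟘⇒≡𝟘 (subst (□^ k x ≤_) □^i≡𝟘 (□^-antitone x (ℕ.≤-trans (ℕ.<⇒≤ i<n) n≤k)))

  select-𝟘 : ∀ x z → ((𝟘 ∧ z) ∨ ((neg 𝟘) ∧ x)) ≡ x
  select-𝟘 x z rewrite minimum z | neg-𝟘 | ∧-identityˡ x = ∨-identityˡ x

  select-𝟙 : ∀ x z → ((𝟙 ∧ z) ∨ ((neg 𝟙) ∧ x)) ≡ z
  select-𝟙 x z rewrite ∧-identityˡ z | neg-𝟙 | minimum x = ∨-identityʳ z

  discriminatorTerm-isDiscriminator : SubdirectlyIrreducible A → ((n , _) : Finite A) →
                                      ∀ {k} → n ℕ.≤ k → IsDiscriminator (discriminatorTerm k) A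
  discriminatorTerm-isDiscriminator si fin {k} n≤k =
    (λ x y z x≢y → trans (selector-by (□^-eventually-𝟘 si fin (x≢y ∘ ⇔≡𝟙⇒≡) n≤k)) (select-𝟘 x z)) ,
    (λ x z → trans (selector-by (trans (cong (□^ k) (⇔-refl x)) (□^-𝟙 k))) (select-𝟙 x z))
    where
    selector-by : ∀ {ρ d} → □^ k ((ρ x₀ ⇒ ρ x₁) ∧ (ρ x₁ ⇒ ρ x₀)) ≡ d →
                  ⟦ discriminatorTerm k ⟧ A ρ ≡ ((d ∧ ρ x₂) ∨ ((neg d) ∧ ρ x₀))
    selector-by {ρ} eq = cong (λ d → (d ∧ ρ x₂) ∨ ((neg d) ∧ ρ x₀)) (trans (⟦□'^⟧ k _ ρ) eq)

cardinalityBound : ∀ {a} {K : List (Algebra a)} → All Finite K → ℕ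
cardinalityBound []              = 0
cardinalityBound ((n , _) ∷ fs) = n + cardinalityBound fs

lookup≤cardinalityBound : ∀ {a} {K : List (Algebra a)} {A} (fs : All Finite K) (A∈K : A ∈ K) →
                          proj₁ (All.lookup fs A∈K) ℕ.≤ cardinalityBound fs
lookup≤cardinalityBound (_ ∷ fs) (here refl) = ℕ.m≤m+n _ _
lookup≤cardinalityBound (_ ∷ fs) (there A∈K) = ℕ.≤-trans (lookup≤cardinalityBound fs A∈K) (ℕ.m≤n+m _ _)

theorem4p3 : ∀ {a : Level} (K : List (Algebra a)) →
    All (λ A → IsHAI A × Finite A × SubdirectlyIrreducible A) K →
    IsDiscriminatorVariety (V (fromList K))
theorem4p3 K hypotheses =
  fromList K ,
  (λ A A∈K _ _ _ K⊨s≈t → K⊨s≈t A A∈K) ,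
  (λ A → mk⇔ (λ VA → VA) (λ VA → VA)) ,
  discriminatorTerm k ,
  λ A A∈K → let (hai , _ , si) = All.lookup hypotheses A∈K in
    HeytingAlgebraWithInvolution.discriminatorTerm-isDiscriminator A hai si
      (All.lookup finiteness A∈K) (lookup≤cardinalityBound finiteness A∈K)
  where
  finiteness : All Finite K
  finiteness = All.map proj₁ (All.map proj₂ hypotheses)
  k : ℕ
  k = cardinalityBound finiteness
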